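{- Let $n\ge1$ be an integer, ${\cal I}=\{(i,j)\mid 1\le i\le n,\ 1\le j\le n+1\}$, and let $S\subseteq{\cal I}$ be such that there exist a permutation $\sigma$ of $\{1,\dots,n\}$ and a permutation $\pi$ of $\{1,\dots,n+1\}$ with $S=\{(\sigma(i),\pi(j))\mid (i,j)\in{\cal I},\ i+j\le n+1\}$. Then ${\cal B}_0(S)$ is a Markov basis for $S$.
   Context: A table is an array on ${\cal I}$ with entries in $\mathbb{N}=\{0,1,2,\dots\}$; the fiber of a table $X$ is the set of tables with the same row sums, column sums and sum of entries over $S$. A move for $S$ is an integer array on ${\cal I}$ with all row and column sums $0$ and entries over $S$ summing to $0$. A Markov basis for $S$ is a finite set ${\cal B}$ of moves for $S$, closed under negation, such that for every fiber ${\cal F}$ and all $X,Y\in{\cal F}$ there exist $\alpha\ge1$ and $B_1,\dots,B_\alpha\in{\cal B}$ with $Y=X+\sum_{s=1}^\alpha B_s$ and $X+\sum_{s=1}^a B_s\in{\cal F}$ for $1\le a\le\alpha$. For $i\ne i'$, $j\ne j'$, the basic move $B(i,i';j,j')$ has $+1$ at $(i,j),(i',j')$, $-1$ at $(i,j'),(i',j)$, $0$ elsewhere; ${\cal B}_0(S)$ is the set of basic moves that are moves for $S$. -}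

module Defs where

open import Data.Nat as ℕ using (ℕ; zero; suc)
open import Data.Integer using (ℤ; 0ℤ; 1ℤ; -1ℤ; +_; _+_; -_; _≤_)
open import Data.Fin using (Fin; zero; suc; _≟_)
open import Data.Bool using (Bool; true; false; if_then_else_; _∧_; _∨_)
open import Data.Product using (Σ; ∃; _×_; _,_)
open import Data.List using (List; []; _∷_)
open import Data.List.Relation.Unary.All using (All)
open import Data.List.Relation.Unary.Any using (Any)
open import Relation.Binary.PropositionalEquality using (_≡_; _≢_)
open import Relation.Nullary.Decidable using (⌊_⌋)

-- An array on I = Fin r × Fin c (0-based indices) with entries in A.
Array : ℕ → ℕ → Set → Set
Array r c A = Fin r → Fin c → A

Subset : ℕ → ℕ → Set
Subset r c = Fin r → Fin c → Bool

sumℤ : ∀ {k} → (Fin k → ℤ) → ℤ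
sumℤ {zero}  f = 0ℤ
sumℤ {suc k} f = f zero + sumℤ (λ i → f (suc i))

module _ {r c : ℕ} where

  rowSum : Array r c ℤ → Fin r → ℤ
  rowSum X i = sumℤ (λ j → X i j)

  colSum : Array r c ℤ → Fin c → ℤ
  colSum X j = sumℤ (λ i → X i j)

  SSum : Subset r c → Array r c ℤ → ℤ
  SSum S X = sumℤ (λ i → sumℤ (λ j → if S i j then X i j else 0ℤ))

  toℤ : Array r c ℕ → Array r c ℤ
  toℤ X i j = + (X i j)

  _⊕_ : Array r c ℤ → Array r c ℤ → Array r c ℤ
  (X ⊕ Y) i j = X i j + Y i j

  neg : Array r c ℤ → Array r c ℤ
  neg X i j = - (X i j)

  _≈_ : Array r c ℤ → Array r c ℤ → Set
  X ≈ Y = ∀ i j → X i j ≡ Y i j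

  SameMargins : Subset r c → Array r c ℤ → Array r c ℤ → Set
  SameMargins S X Y =
    (∀ i → rowSum X i ≡ rowSum Y i) × (∀ j → colSum X j ≡ colSum Y j) × (SSum S X ≡ SSum S Y)

  InFiberOf : Subset r c → Array r c ℕ → Array r c ℤ → Set
  InFiberOf S X Z = (∀ i j → 0ℤ ≤ Z i j) × SameMargins S (toℤ X) Z

  IsMove : Subset r c → Array r c ℤ → Set
  IsMove S M = (∀ i → rowSum M i ≡ 0ℤ) × (∀ j → colSum M j ≡ 0ℤ) × (SSum S M ≡ 0ℤ)

  partialSums : Array r c ℤ → List (Array r c ℤ) → List (Array r c ℤ)
  partialSums X []       = []
  partialSums X (B ∷ Bs) = (X ⊕ B) ∷ partialSums (X ⊕ B) Bs

  total : Array r c ℤ → List (Array r c ℤ) → Array r c ℤ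
  total X []       = X
  total X (B ∷ Bs) = total (X ⊕ B) Bs

  FiniteSet : (Array r c ℤ → Set) → Set
  FiniteSet B = Σ (List (Array r c ℤ)) λ L → ∀ M → B M → Any (M ≈_) L

  IsMarkovBasis : Subset r c → (Array r c ℤ → Set) → Set
  IsMarkovBasis S B =
    FiniteSet B ×
    (∀ M → B M → IsMove S M) ×
    (∀ M → B M → B (neg M)) ×
    (∀ (X Y : Array r c ℕ) → SameMargins S (toℤ X) (toℤ Y) →
       Σ (List (Array r c ℤ)) λ Bs →
         All B Bs ×
         All (InFiberOf S X) (partialSums (toℤ X) Bs) ×
         (total (toℤ X) Bs ≈ toℤ Y))

  basicMove : Fin r → Fin r → Fin c → Fin c → Array r c ℤ
  basicMove i i' j j' a b =
    if (⌊ a ≟ i ⌋ ∧ ⌊ b ≟ j ⌋) ∨ (⌊ a ≟ i' ⌋ ∧ ⌊ b ≟ j' ⌋) then 1ℤ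
    else if (⌊ a ≟ i ⌋ ∧ ⌊ b ≟ j' ⌋) ∨ (⌊ a ≟ i' ⌋ ∧ ⌊ b ≟ j ⌋) then -1ℤ
    else 0ℤ

  B₀ : Subset r c → Array r c ℤ → Set
  B₀ S M = ∃ λ i → ∃ λ i' → ∃ λ j → ∃ λ j' →
    i ≢ i' × j ≢ j' × M ≈ basicMove i i' j j' × IsMove S M

-- Relabel row σ(i) by 2i+1 and column π(j) by 2(n−j): the labels are pairwise distinct and S becomes
-- the threshold set of cells whose row label lies below their column label.  Every table is joined
-- inside its fiber, by moves of B₀(S), to a reduced table, one admitting no fiber-preserving basic move
-- that shifts a unit from an increasing pair of cells (i,a), (i',b) to (i,b), (i',a): each such move
-- strictly lowers Σ ρ(p) γ(q) X(p,q) by the rearrangement inequality.  It remains to see that a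
-- reduced table is determined by its margins.  Order the cells by the larger of their two labels and
-- let m be the key of a first positive cell.  Comparing the mass inside and outside S with the totals
-- of the rows and columns labelled below m pins m down from the margins alone; reducedness then
-- forces two reduced tables of the same fiber to share a positive cell in the row or column labelled
-- m, and removing one unit there and inducting on the total mass shows that they coincide.

module Submission where

open import Defs
open import Data.Nat using (ℕ; suc; _+_; _<_; _≤_)
open import Data.Fin using (Fin; toℕ)
open import Data.Fin.Permutation using (Permutation′; _⟨$⟩ʳ_)
open import Data.Bool using (true)
open import Data.Product using (∃; _×_)
open import Function.Bundles using (_⇔_)
open import Relation.Binary.PropositionalEquality using (_≡_)

import Algebra.Properties.Semiring.Sum
open import Data.Bool using (Bool; false; if_then_else_; _∧_; not)
open import Data.Empty using (⊥; ⊥-elim)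
open import Data.Fin using (zero; suc; _≟_)
open import Data.Fin.Permutation using (_⟨$⟩ˡ_; inverseˡ; inverseʳ)
open import Data.Fin.Properties using (suc-injective; any?; toℕ-injective; toℕ<n)
open import Data.Integer as ℤ using (+_)
import Data.Integer.Properties as ℤₚ
open import Data.Integer.Tactic.RingSolver using (solve-∀)
open import Data.List using (List; []; _∷_; map; allFin; cartesianProduct)
open import Data.List.Membership.Propositional.Properties using (∈-map⁺; ∈-cartesianProduct⁺; ∈-allFin)
open import Data.List.Relation.Unary.All using (All; []; _∷_)
import Data.List.Relation.Unary.Any as Any
open import Data.Nat using (zero; _∸_; _*_; _⊔_; z≤n; s≤s; _<?_)
open import Data.Nat.Induction using (<-wellFounded)
import Data.Nat.Properties as ℕₚ
open import Data.Nat.Tactic.RingSolver renaming (solve-∀ to ℕ-solve-∀)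
open import Data.Product using (Σ; ∃₂; _,_)
open import Data.Sum as Sum using (_⊎_; inj₁; inj₂)
open import Function.Base using (_∘_)
open import Function.Bundles using (mk⇔; Equivalence)
open import Function.Definitions using (Injective)
open import Induction.WellFounded using (Acc; acc)
open import Relation.Binary using (tri<; tri≈; tri>)
open import Relation.Binary.PropositionalEquality using (_≢_; refl; sym; trans; cong; cong₂; subst; subst₂; ≢-sym; module ≡-Reasoning)
open import Relation.Nullary using (¬_; Dec; yes; no)
open import Relation.Nullary.Decidable using (⌊_⌋; _×-dec_)

open Algebra.Properties.Semiring.Sum ℕₚ.+-*-semiring
  using (sum; sum-syntax; sum-cong-≗; ∑-distrib-+; ∑-comm; sum-replicate-zero)

𝟙 : Bool → ℕ
𝟙 b = if b then 1 else 0

sum-≡0 : ∀ {k} {f : Fin k → ℕ} → (∀ i → f i ≡ 0) → sum f ≡ 0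
sum-≡0 {k} f≡0 = trans (sum-cong-≗ f≡0) (sum-replicate-zero k)

sum-mono-≤ : ∀ {k} {f g : Fin k → ℕ} → (∀ i → f i ≤ g i) → sum f ≤ sum g
sum-mono-≤ {zero}  _   = z≤n
sum-mono-≤ {suc k} f≤g = ℕₚ.+-mono-≤ (f≤g zero) (sum-mono-≤ (f≤g ∘ suc))

sum-mono-< : ∀ {k} {f g : Fin k → ℕ} → (∀ i → f i ≤ g i) → ∀ j → f j < g j → sum f < sum g
sum-mono-< f≤g zero    fj<gj = ℕₚ.+-mono-<-≤ fj<gj (sum-mono-≤ (f≤g ∘ suc))
sum-mono-< f≤g (suc j) fj<gj = ℕₚ.+-mono-≤-< (f≤g zero) (sum-mono-< (f≤g ∘ suc) j fj<gj)

≤-sum : ∀ {k} (f : Fin k → ℕ) j → f j ≤ sum f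
≤-sum f zero    = ℕₚ.m≤m+n _ _
≤-sum f (suc j) = ℕₚ.≤-trans (≤-sum (f ∘ suc) j) (ℕₚ.m≤n+m _ _)

sum-positive : ∀ {k} (f : Fin k → ℕ) → 0 < sum f → ∃ λ j → 0 < f j
sum-positive {suc k} f pos with f zero in eq
... | suc _ = zero , subst (0 <_) (sym eq) (s≤s z≤n)
... | zero  with sum-positive (f ∘ suc) pos
...   | j , fj>0 = suc j , fj>0

sum-single : ∀ {k} (f : Fin k → ℕ) j → (∀ i → i ≢ j → f i ≡ 0) → sum f ≡ f j
sum-single f zero    f≡0 = trans (cong (_+_ (f zero)) (sum-≡0 (λ i → f≡0 (suc i) λ ()))) (ℕₚ.+-identityʳ _)
sum-single f (suc j) f≡0 =
  cong₂ _+_ (f≡0 zero λ ()) (sum-single (f ∘ suc) j (λ i i≢j → f≡0 (suc i) (i≢j ∘ suc-injective)))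

¬>0⇒≡0 : ∀ {n} → ¬ 0 < n → n ≡ 0
¬>0⇒≡0 n≯0 = ℕₚ.n≤0⇒n≡0 (ℕₚ.≮⇒≥ n≯0)

sumBelow : ∀ {k} → (Fin k → ℕ) → (Fin k → ℕ) → ℕ → ℕ
sumBelow {k} level w m = ∑[ i < k ] (if ⌊ level i <? m ⌋ then w i else 0)

module _ {k} (level w : Fin k → ℕ) where

  sumBelow-mono : ∀ {m m'} → m ≤ m' → sumBelow level w m ≤ sumBelow level w m'
  sumBelow-mono {m} {m'} m≤m' = sum-mono-≤ termwise
    where
    termwise : ∀ i → (if ⌊ level i <? m ⌋ then w i else 0) ≤ (if ⌊ level i <? m' ⌋ then w i else 0)
    termwise i with level i <? m | level i <? m'
    ... | yes _   | yes _    = ℕₚ.≤-refl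
    ... | yes l<m | no l≮m' = ⊥-elim (l≮m' (ℕₚ.<-≤-trans l<m m≤m'))
    ... | no _    | _        = z≤n

  sumBelow-≤ : ∀ {m} {v : Fin k → ℕ} → (∀ i → level i < m → w i ≤ v i) → sumBelow level w m ≤ sum v
  sumBelow-≤ {m} w≤v = sum-mono-≤ termwise
    where
    termwise : ∀ i → (if ⌊ level i <? m ⌋ then w i else 0) ≤ _
    termwise i with level i <? m
    ... | yes l<m = w≤v i l<m
    ... | no _    = z≤n

  sum-<-sumBelow : ∀ {m} {v : Fin k → ℕ} → (∀ i → v i ≤ w i) → (∀ i → m ≤ level i → v i ≡ 0) →
    ∀ j → level j < m → v j < w j → sum v < sumBelow level w m
  sum-<-sumBelow {m} {v} v≤w v≡0 j lj<m vj<wj = sum-mono-< termwise j strict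
    where
    termwise : ∀ i → v i ≤ (if ⌊ level i <? m ⌋ then w i else 0)
    termwise i with level i <? m
    ... | yes _   = v≤w i
    ... | no l≮m = ℕₚ.≤-reflexive (v≡0 i (ℕₚ.≮⇒≥ l≮m))
    strict : v j < (if ⌊ level j <? m ⌋ then w j else 0)
    strict with level j <? m
    ... | yes _   = vj<wj
    ... | no l≮m = ⊥-elim (l≮m lj<m)

sumBelow-cong : ∀ {k} (level : Fin k → ℕ) {w w' : Fin k → ℕ} → (∀ i → w i ≡ w' i) →
  ∀ m → sumBelow level w m ≡ sumBelow level w' m
sumBelow-cong level w≡w' m = sum-cong-≗ (λ i → cong (λ x → if ⌊ level i <? m ⌋ then x else 0) (w≡w' i))

sumℤ-cong : ∀ {k} {f g : Fin k → ℤ.ℤ} → (∀ i → f i ≡ g i) → sumℤ f ≡ sumℤ g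
sumℤ-cong {zero}  _   = refl
sumℤ-cong {suc k} f≡g = cong₂ ℤ._+_ (f≡g zero) (sumℤ-cong (f≡g ∘ suc))

sumℤ-+ : ∀ {k} (f : Fin k → ℕ) → sumℤ (λ i → + f i) ≡ + sum f
sumℤ-+ {zero}  f = refl
sumℤ-+ {suc k} f = trans (cong (ℤ._+_ (+ f zero)) (sumℤ-+ (f ∘ suc))) (sym (ℤₚ.pos-+ (f zero) _))

x+[y-z]≡[x+y]-z : ∀ (x y z : ℤ.ℤ) → x ℤ.+ (y ℤ.- z) ≡ (x ℤ.+ y) ℤ.- z
x+[y-z]≡[x+y]-z = solve-∀

[x+y]-y≡x : ∀ (x y : ℤ.ℤ) → (x ℤ.+ y) ℤ.- y ≡ x
[x+y]-y≡x = solve-∀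

-[x-y]≡y-x : ∀ (x y : ℤ.ℤ) → ℤ.- (x ℤ.- y) ≡ y ℤ.- x
-[x-y]≡y-x = solve-∀

[x-y]+[z-w]≡[x+z]-[y+w] : ∀ (x y z w : ℤ.ℤ) → (x ℤ.- y) ℤ.+ (z ℤ.- w) ≡ (x ℤ.+ z) ℤ.- (y ℤ.+ w)
[x-y]+[z-w]≡[x+z]-[y+w] = solve-∀

sumℤ-diff : ∀ {k} (f g : Fin k → ℕ) → sumℤ (λ i → + f i ℤ.- + g i) ≡ + sum f ℤ.- + sum g
sumℤ-diff {zero}  f g = refl
sumℤ-diff {suc k} f g = begin
  (+ f zero ℤ.- + g zero) ℤ.+ sumℤ (λ i → + f (suc i) ℤ.- + g (suc i))
    ≡⟨ cong (ℤ._+_ (+ f zero ℤ.- + g zero)) (sumℤ-diff (f ∘ suc) (g ∘ suc)) ⟩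
  (+ f zero ℤ.- + g zero) ℤ.+ (+ sum (f ∘ suc) ℤ.- + sum (g ∘ suc))
    ≡⟨ [x-y]+[z-w]≡[x+z]-[y+w] (+ f zero) (+ g zero) (+ sum (f ∘ suc)) (+ sum (g ∘ suc)) ⟩
  (+ f zero ℤ.+ + sum (f ∘ suc)) ℤ.- (+ g zero ℤ.+ + sum (g ∘ suc))
    ≡⟨ cong₂ ℤ._-_ (sym (ℤₚ.pos-+ (f zero) _)) (sym (ℤₚ.pos-+ (g zero) _)) ⟩
  + sum f ℤ.- + sum g ∎
  where
  open ≡-Reasoning

Table : ℕ → ℕ → Set
Table r c = Array r c ℕ

module _ {r c : ℕ} where

  infix 4 _≋_
  infixl 6 _⊞_

  _≋_ : Table r c → Table r c → Set
  X ≋ Y = ∀ p q → X p q ≡ Y p q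

  _⊞_ : Table r c → Table r c → Table r c
  (X ⊞ Y) p q = X p q + Y p q

  rowTotal : Table r c → Fin r → ℕ
  rowTotal X p = ∑[ q < c ] X p q

  colTotal : Table r c → Fin c → ℕ
  colTotal X q = ∑[ p < r ] X p q

  mass : Table r c → ℕ
  mass X = ∑[ p < r ] rowTotal X p

  restrict : Subset r c → Table r c → Table r c
  restrict S X p q = if S p q then X p q else 0

  ∁ : Subset r c → Subset r c
  ∁ S p q = not (S p q)

  δ : Fin r → Fin c → Table r c
  δ i j p q = 𝟙 (⌊ p ≟ i ⌋ ∧ ⌊ q ≟ j ⌋)

  rowTotal-⊞ : ∀ X Y p → rowTotal (X ⊞ Y) p ≡ rowTotal X p + rowTotal Y p
  rowTotal-⊞ X Y p = ∑-distrib-+ (X p) (Y p)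

  colTotal-⊞ : ∀ X Y q → colTotal (X ⊞ Y) q ≡ colTotal X q + colTotal Y q
  colTotal-⊞ X Y q = ∑-distrib-+ (λ p → X p q) (λ p → Y p q)

  mass-⊞ : ∀ X Y → mass (X ⊞ Y) ≡ mass X + mass Y
  mass-⊞ X Y = trans (sum-cong-≗ (rowTotal-⊞ X Y)) (∑-distrib-+ (rowTotal X) (rowTotal Y))

  mass-cong : ∀ {X Y} → X ≋ Y → mass X ≡ mass Y
  mass-cong X≋Y = sum-cong-≗ (λ p → sum-cong-≗ (X≋Y p))

  mass-colTotal : ∀ X → mass X ≡ ∑[ q < c ] colTotal X q
  mass-colTotal X = ∑-comm X

  ≤-mass : ∀ X p q → X p q ≤ mass X
  ≤-mass X p q = ℕₚ.≤-trans (≤-sum (X p) q) (≤-sum (rowTotal X) p)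

  mass-positive : ∀ X → 0 < mass X → ∃₂ λ p q → 0 < X p q
  mass-positive X pos with sum-positive (rowTotal X) pos
  ... | p , row>0 with sum-positive (X p) row>0
  ...   | q , X>0 = p , q , X>0

  mass-single : ∀ X i j → (∀ p q → p ≢ i ⊎ q ≢ j → X p q ≡ 0) → mass X ≡ X i j
  mass-single X i j X≡0 = trans
    (sum-single (rowTotal X) i (λ p p≢i → sum-≡0 (λ q → X≡0 p q (inj₁ p≢i))))
    (sum-single (X i) j (λ q q≢j → X≡0 i q (inj₂ q≢j)))

  restrict-⊞ : ∀ S X Y → restrict S (X ⊞ Y) ≋ restrict S X ⊞ restrict S Y
  restrict-⊞ S X Y p q with S p q
  ... | true  = refl
  ... | false = refl

  restrict-∁-⊞ : ∀ S X → X ≋ restrict S X ⊞ restrict (∁ S) X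
  restrict-∁-⊞ S X p q with S p q
  ... | true  = sym (ℕₚ.+-identityʳ _)
  ... | false = refl

  restrict-≤ : ∀ S X p q → restrict S X p q ≤ X p q
  restrict-≤ S X p q with S p q
  ... | true  = ℕₚ.≤-refl
  ... | false = z≤n

  ≤-restrict : ∀ S X p q → (0 < X p q → S p q ≡ true) → X p q ≤ restrict S X p q
  ≤-restrict S X p q inS with S p q | X p q | inS
  ... | true  | _     | _   = ℕₚ.≤-refl
  ... | false | zero  | _   = z≤n
  ... | false | suc _ | inS with inS (s≤s z≤n)
  ...   | ()

  δ-off : ∀ i j p q → p ≢ i ⊎ q ≢ j → δ i j p q ≡ 0
  δ-off i j p q off with p ≟ i | q ≟ j | off
  ... | yes p≡i | yes q≡j | inj₁ p≢i = ⊥-elim (p≢i p≡i)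
  ... | yes p≡i | yes q≡j | inj₂ q≢j = ⊥-elim (q≢j q≡j)
  ... | yes _   | no _    | _        = refl
  ... | no _    | _       | _        = refl

  δ-diag : ∀ i j → δ i j i j ≡ 1
  δ-diag i j with i ≟ i | j ≟ j
  ... | yes _ | yes _  = refl
  ... | yes _ | no j≢j = ⊥-elim (j≢j refl)
  ... | no i≢i | _     = ⊥-elim (i≢i refl)

  rowTotal-δ : ∀ i j p → rowTotal (δ i j) p ≡ 𝟙 ⌊ p ≟ i ⌋
  rowTotal-δ i j p = trans (sum-single (δ i j p) j (λ q q≢j → δ-off i j p q (inj₂ q≢j))) (diag p)
    where
    diag : ∀ p → δ i j p j ≡ 𝟙 ⌊ p ≟ i ⌋
    diag p with p ≟ i | j ≟ j
    ... | no _  | _      = refl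
    ... | yes _ | yes _  = refl
    ... | yes _ | no j≢j = ⊥-elim (j≢j refl)

  colTotal-δ : ∀ i j q → colTotal (δ i j) q ≡ 𝟙 ⌊ q ≟ j ⌋
  colTotal-δ i j q = trans (sum-single (λ p → δ i j p q) i (λ p p≢i → δ-off i j p q (inj₁ p≢i))) (diag q)
    where
    diag : ∀ q → δ i j i q ≡ 𝟙 ⌊ q ≟ j ⌋
    diag q with i ≟ i
    ... | yes _  = refl
    ... | no i≢i = ⊥-elim (i≢i refl)

  mass-δ : ∀ i j → mass (δ i j) ≡ 1
  mass-δ i j = trans (mass-single (δ i j) i j (δ-off i j)) (δ-diag i j)

  mass-restrict-δ : ∀ S i j → mass (restrict S (δ i j)) ≡ 𝟙 (S i j)
  mass-restrict-δ S i j = trans (mass-single _ i j (λ p q off → restrict-zero S {X = δ i j} (δ-off i j p q off)))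
                                (cong (λ x → if S i j then x else 0) (δ-diag i j))
    where
    restrict-zero : ∀ S {p q} {X : Table r c} → X p q ≡ 0 → restrict S X p q ≡ 0
    restrict-zero S {p} {q} X≡0 with S p q
    ... | true  = X≡0
    ... | false = refl

  mass≡0⇒≡0 : ∀ X → mass X ≡ 0 → ∀ p q → X p q ≡ 0
  mass≡0⇒≡0 X mass≡0 p q = ℕₚ.n≤0⇒n≡0 (subst (X p q ≤_) mass≡0 (≤-mass X p q))

  decrement : Table r c → Fin r → Fin c → Table r c
  decrement X i j p q = X p q ∸ δ i j p q

  decrement-⊞ : ∀ {X i j} → 0 < X i j → decrement X i j ⊞ δ i j ≋ X
  decrement-⊞ {X} {i} {j} Xij>0 p q = ℕₚ.m∸n+n≡m (δ≤X p q)
    where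
    δ≤X : ∀ p q → δ i j p q ≤ X p q
    δ≤X p q with p ≟ i | q ≟ j
    ... | yes refl | yes refl = Xij>0
    ... | yes _    | no _     = z≤n
    ... | no _     | _        = z≤n

  decrement-≋ : ∀ {X Y i j} → 0 < X i j → 0 < Y i j → decrement X i j ≋ decrement Y i j → X ≋ Y
  decrement-≋ {X} {Y} {i} {j} Xij>0 Yij>0 rest≋ p q = begin
    X p q                           ≡⟨ decrement-⊞ Xij>0 p q ⟨
    decrement X i j p q + δ i j p q ≡⟨ cong (_+ δ i j p q) (rest≋ p q) ⟩
    decrement Y i j p q + δ i j p q ≡⟨ decrement-⊞ Yij>0 p q ⟩
    Y p q                           ∎
    where open ≡-Reasoning

  decrement-≤ : ∀ X i j p q → decrement X i j p q ≤ X p q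
  decrement-≤ X i j p q = ℕₚ.m∸n≤m (X p q) (δ i j p q)

  mass-decrement : ∀ {X i j} → 0 < X i j → mass (decrement X i j) < mass X
  mass-decrement {X} {i} {j} Xij>0 = subst (mass (decrement X i j) <_) mass≡ (ℕₚ.m<m+n _ (s≤s z≤n))
    where
    mass≡ : mass (decrement X i j) + 1 ≡ mass X
    mass≡ = trans (cong (_+_ (mass (decrement X i j))) (sym (mass-δ i j)))
                  (trans (sym (mass-⊞ _ _)) (mass-cong (decrement-⊞ Xij>0)))

  record SameMarginsℕ (S : Subset r c) (X Y : Table r c) : Set where
    field
      rows   : ∀ p → rowTotal X p ≡ rowTotal Y p
      cols   : ∀ q → colTotal X q ≡ colTotal Y q
      inside : mass (restrict S X) ≡ mass (restrict S Y)

  open SameMarginsℕ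

  module _ {S : Subset r c} where

    sameMargins-≋ : ∀ {X Y} → X ≋ Y → SameMarginsℕ S X Y
    sameMargins-≋ X≋Y = record
      { rows   = λ p → sum-cong-≗ (X≋Y p)
      ; cols   = λ q → sum-cong-≗ (λ p → X≋Y p q)
      ; inside = mass-cong (λ p q → cong (λ x → if S p q then x else 0) (X≋Y p q))
      }

    sameMargins-sym : ∀ {X Y} → SameMarginsℕ S X Y → SameMarginsℕ S Y X
    sameMargins-sym sm = record
      { rows = λ p → sym (rows sm p) ; cols = λ q → sym (cols sm q) ; inside = sym (inside sm) }

    sameMargins-trans : ∀ {X Y Z} → SameMarginsℕ S X Y → SameMarginsℕ S Y Z → SameMarginsℕ S X Z
    sameMargins-trans sm sm' = record
      { rows   = λ p → trans (rows sm p) (rows sm' p)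
      ; cols   = λ q → trans (cols sm q) (cols sm' q)
      ; inside = trans (inside sm) (inside sm')
      }

    sameMargins-cancel : ∀ {X Y Z W} → SameMarginsℕ S (X ⊞ Z) (Y ⊞ W) → SameMarginsℕ S Z W → SameMarginsℕ S X Y
    sameMargins-cancel {X} {Y} {Z} {W} sm smᶻ = record
      { rows   = λ p → cancel (rowTotal-⊞ X Z p) (rowTotal-⊞ Y W p) (rows sm p) (rows smᶻ p)
      ; cols   = λ q → cancel (colTotal-⊞ X Z q) (colTotal-⊞ Y W q) (cols sm q) (cols smᶻ q)
      ; inside = cancel (masses X Z) (masses Y W) (inside sm) (inside smᶻ)
      }
      where
      cancel : ∀ {x y z w xz yw} → xz ≡ x + z → yw ≡ y + w → xz ≡ yw → z ≡ w → x ≡ y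
      cancel {x} {y} {z} refl refl x+z≡y+w refl = ℕₚ.+-cancelʳ-≡ z x y x+z≡y+w
      masses : ∀ A B → mass (restrict S (A ⊞ B)) ≡ mass (restrict S A) + mass (restrict S B)
      masses A B = trans (mass-cong (restrict-⊞ S A B)) (mass-⊞ _ _)

    sameMargins-mass : ∀ {X Y} → SameMarginsℕ S X Y → mass X ≡ mass Y
    sameMargins-mass sm = sum-cong-≗ (rows sm)

    sameMargins-outside : ∀ {X Y} → SameMarginsℕ S X Y → mass (restrict (∁ S) X) ≡ mass (restrict (∁ S) Y)
    sameMargins-outside {X} {Y} sm = ℕₚ.+-cancelˡ-≡ (mass (restrict S X)) _ _ (begin
      mass (restrict S X) + mass (restrict (∁ S) X) ≡⟨ split X ⟩
      mass X                                        ≡⟨ sameMargins-mass sm ⟩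
      mass Y                                        ≡⟨ split Y ⟨
      mass (restrict S Y) + mass (restrict (∁ S) Y) ≡⟨ cong (_+ mass (restrict (∁ S) Y)) (inside sm) ⟨
      mass (restrict S X) + mass (restrict (∁ S) Y) ∎)
      where
      open ≡-Reasoning
      split : ∀ A → mass (restrict S A) + mass (restrict (∁ S) A) ≡ mass A
      split A = sym (trans (mass-cong (restrict-∁-⊞ S A)) (mass-⊞ _ _))

    sameMargins-decrement : ∀ {X Y i j} → 0 < X i j → 0 < Y i j → SameMarginsℕ S X Y →
      SameMarginsℕ S (decrement X i j) (decrement Y i j)
    sameMargins-decrement Xij>0 Yij>0 sm = sameMargins-cancel
      (sameMargins-trans (sameMargins-≋ (decrement-⊞ Xij>0))
        (sameMargins-trans sm (sameMargins-sym (sameMargins-≋ (decrement-⊞ Yij>0)))))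
      (sameMargins-≋ (λ _ _ → refl))

    rowTotal-positive : ∀ {X Y p q} → SameMarginsℕ S X Y → 0 < Y p q → 0 < rowTotal X p
    rowTotal-positive {Y = Y} {p} {q} sm Ypq>0 =
      subst (0 <_) (sym (rows sm p)) (ℕₚ.<-≤-trans Ypq>0 (≤-sum (Y p) q))

    colTotal-positive : ∀ {X Y p q} → SameMarginsℕ S X Y → 0 < Y p q → 0 < colTotal X q
    colTotal-positive {Y = Y} {p} {q} sm Ypq>0 =
      subst (0 <_) (sym (cols sm q)) (ℕₚ.<-≤-trans Ypq>0 (≤-sum (λ p → Y p q) p))

  -- Basic steps and paths

  Balanced : Subset r c → Fin r → Fin r → Fin c → Fin c → Set
  Balanced S i i' j j' = 𝟙 (S i j) + 𝟙 (S i' j') ≡ 𝟙 (S i j') + 𝟙 (S i' j)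

  plusPart minusPart : Fin r → Fin r → Fin c → Fin c → Table r c
  plusPart  i i' j j' = δ i j ⊞ δ i' j'
  minusPart i i' j j' = plusPart i i' j' j

  plusPart-≤ : ∀ {X : Table r c} {i i' j j'} → i ≢ i' → 0 < X i j → 0 < X i' j' → ∀ p q → plusPart i i' j j' p q ≤ X p q
  plusPart-≤ {X} {i} {i'} {j} {j'} i≢i' Xij>0 Xi'j'>0 p q with p ≟ i | p ≟ i' | q ≟ j | q ≟ j'
  ... | yes refl | yes refl | _        | _        = ⊥-elim (i≢i' refl)
  ... | yes refl | no _     | yes refl | _        = Xij>0
  ... | yes _    | no _     | no _     | _        = z≤n
  ... | no _     | yes refl | _        | yes refl = Xi'j'>0
  ... | no _     | yes _    | _        | no _     = z≤n
  ... | no _     | no _     | _        | _        = z≤n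

  rowTotal-plusPart : ∀ i i' j j' p → rowTotal (plusPart i i' j j') p ≡ 𝟙 ⌊ p ≟ i ⌋ + 𝟙 ⌊ p ≟ i' ⌋
  rowTotal-plusPart i i' j j' p =
    trans (rowTotal-⊞ (δ i j) (δ i' j') p) (cong₂ _+_ (rowTotal-δ i j p) (rowTotal-δ i' j' p))

  colTotal-plusPart : ∀ i i' j j' q → colTotal (plusPart i i' j j') q ≡ 𝟙 ⌊ q ≟ j ⌋ + 𝟙 ⌊ q ≟ j' ⌋
  colTotal-plusPart i i' j j' q =
    trans (colTotal-⊞ (δ i j) (δ i' j') q) (cong₂ _+_ (colTotal-δ i j q) (colTotal-δ i' j' q))

  mass-restrict-plusPart : ∀ S i i' j j' → mass (restrict S (plusPart i i' j j')) ≡ 𝟙 (S i j) + 𝟙 (S i' j')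
  mass-restrict-plusPart S i i' j j' = trans (mass-cong (restrict-⊞ S (δ i j) (δ i' j')))
    (trans (mass-⊞ _ _) (cong₂ _+_ (mass-restrict-δ S i j) (mass-restrict-δ S i' j')))

  balanced⇒sameMargins : ∀ {S i i' j j'} →
    Balanced S i i' j j' → SameMarginsℕ S (plusPart i i' j j') (minusPart i i' j j')
  balanced⇒sameMargins {S} {i} {i'} {j} {j'} bal = record
    { rows   = λ p → trans (rowTotal-plusPart i i' j j' p) (sym (rowTotal-plusPart i i' j' j p))
    ; cols   = λ q → trans (colTotal-plusPart i i' j j' q)
                        (trans (ℕₚ.+-comm (𝟙 ⌊ q ≟ j ⌋) _) (sym (colTotal-plusPart i i' j' j q)))
    ; inside = trans (mass-restrict-plusPart S i i' j j') (trans bal (sym (mass-restrict-plusPart S i i' j' j)))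
    }

  record BasicStep (S : Subset r c) (X Y : Table r c) : Set where
    constructor basicStep
    field
      i i'     : Fin r
      j j'     : Fin c
      i≢i'     : i ≢ i'
      j≢j'     : j ≢ j'
      balanced : Balanced S i i' j j'
      -- Y = X + B(i,i';j,j'), with the negative part moved across so that no subtraction occurs.
      result   : Y ⊞ minusPart i i' j j' ≋ X ⊞ plusPart i i' j j'

    move : Array r c ℤ.ℤ
    move = basicMove i i' j j'

  infixr 5 _◅_

  -- Tables are functions, so a path fixes its endpoint only up to pointwise equality.
  data Path (S : Subset r c) : Table r c → Table r c → Set where
    end : ∀ {X Y} → X ≋ Y → Path S X Y
    _◅_ : ∀ {X Y Z} → BasicStep S X Y → Path S Y Z → Path S X Z

  module _ {S : Subset r c} where

    basicStep-from : ∀ {X} i i' j j' → i ≢ i' → j ≢ j' → Balanced S i i' j j' →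
      (∀ p q → minusPart i i' j j' p q ≤ X p q) →
      BasicStep S X (λ p q → X p q + plusPart i i' j j' p q ∸ minusPart i i' j j' p q)
    basicStep-from i i' j j' i≢i' j≢j' bal minus≤X = basicStep i i' j j' i≢i' j≢j' bal
      (λ p q → ℕₚ.m∸n+n≡m (ℕₚ.≤-trans (minus≤X p q) (ℕₚ.m≤m+n _ _)))

    basicStep-sym : ∀ {X Y} → BasicStep S X Y → BasicStep S Y X
    basicStep-sym (basicStep i i' j j' i≢i' j≢j' bal res) =
      basicStep i i' j' j i≢i' (≢-sym j≢j') (sym bal) (λ p q → sym (res p q))

    basicStep-respˡ : ∀ {X X' Y} → X ≋ X' → BasicStep S X' Y → BasicStep S X Y
    basicStep-respˡ X≋X' (basicStep i i' j j' i≢i' j≢j' bal res) = basicStep i i' j j' i≢i' j≢j' bal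
      (λ p q → trans (res p q) (cong (_+ plusPart i i' j j' p q) (sym (X≋X' p q))))

    basicStep-sameMargins : ∀ {X Y} → BasicStep S X Y → SameMarginsℕ S X Y
    basicStep-sameMargins (basicStep i i' j j' _ _ bal res) = sameMargins-sym
      (sameMargins-cancel (sameMargins-≋ res) (sameMargins-sym (balanced⇒sameMargins bal)))

    path-respˡ : ∀ {X X' Y} → X ≋ X' → Path S X' Y → Path S X Y
    path-respˡ X≋X' (end X'≋Y) = end (λ p q → trans (X≋X' p q) (X'≋Y p q))
    path-respˡ X≋X' (s ◅ π)    = basicStep-respˡ X≋X' s ◅ π

    infixr 5 _◅◅_
    _◅◅_ : ∀ {X Y Z} → Path S X Y → Path S Y Z → Path S X Z
    end X≋Y ◅◅ π' = path-respˡ X≋Y π'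
    (s ◅ π) ◅◅ π' = s ◅ (π ◅◅ π')

    reverse : ∀ {X Y} → Path S X Y → Path S Y X
    reverse (end X≋Y) = end (λ p q → sym (X≋Y p q))
    reverse (s ◅ π)   = reverse π ◅◅ (basicStep-sym s ◅ end (λ _ _ → refl))

    path-sameMargins : ∀ {X Y} → Path S X Y → SameMarginsℕ S X Y
    path-sameMargins (end X≋Y) = sameMargins-≋ X≋Y
    path-sameMargins (s ◅ π)   = sameMargins-trans (basicStep-sameMargins s) (path-sameMargins π)

  -- Markov bases from paths

  record IsDifference (D : Array r c ℤ.ℤ) (P M : Table r c) : Set where
    constructor difference
    field
      _at_ : ∀ p q → D p q ≡ + P p q ℤ.- + M p q

  open IsDifference

  basicMove-difference : ∀ {i i' j j'} → i ≢ i' → j ≢ j' →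
    IsDifference (basicMove i i' j j') (plusPart i i' j j') (minusPart i i' j j')
  basicMove-difference {i} {i'} {j} {j'} i≢i' j≢j' = difference cellwise
    where
    cellwise : ∀ p q → basicMove i i' j j' p q ≡ + plusPart i i' j j' p q ℤ.- + minusPart i i' j j' p q
    cellwise p q with p ≟ i | p ≟ i' | q ≟ j | q ≟ j'
    ... | yes refl | yes refl | _     | _     = ⊥-elim (i≢i' refl)
    ... | _     | _     | yes refl | yes refl = ⊥-elim (j≢j' refl)
    ... | yes _ | no _  | yes _ | no _  = refl
    ... | yes _ | no _  | no _  | yes _ = refl
    ... | yes _ | no _  | no _  | no _  = refl
    ... | no _  | yes _ | yes _ | no _  = refl
    ... | no _  | yes _ | no _  | yes _ = refl
    ... | no _  | yes _ | no _  | no _  = refl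
    ... | no _  | no _  | yes _ | no _  = refl
    ... | no _  | no _  | no _  | yes _ = refl
    ... | no _  | no _  | no _  | no _  = refl

  module _ {S : Subset r c} where

    rowSum-difference : ∀ {D P M} → IsDifference D P M → ∀ p → rowSum D p ≡ + rowTotal P p ℤ.- + rowTotal M p
    rowSum-difference {P = P} {M} D≡ p = trans (sumℤ-cong ((D≡ at p))) (sumℤ-diff (P p) (M p))

    colSum-difference : ∀ {D P M} → IsDifference D P M → ∀ q → colSum D q ≡ + colTotal P q ℤ.- + colTotal M q
    colSum-difference {P = P} {M} D≡ q = trans (sumℤ-cong (λ p → (D≡ at p) q)) (sumℤ-diff (λ p → P p q) (λ p → M p q))

    SSum-difference : ∀ {D P M} → IsDifference D P M →
      SSum S D ≡ + mass (restrict S P) ℤ.- + mass (restrict S M)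
    SSum-difference {D} {P} {M} D≡ =
      trans (sumℤ-cong (rowSum-difference restricted)) (sumℤ-diff (rowTotal (restrict S P)) (rowTotal (restrict S M)))
      where
      restricted : IsDifference (λ p q → if S p q then D p q else ℤ.0ℤ) (restrict S P) (restrict S M)
      restricted = difference cellwise
        where
        cellwise : ∀ p q → (if S p q then D p q else ℤ.0ℤ) ≡ + restrict S P p q ℤ.- + restrict S M p q
        cellwise p q with S p q
        ... | true  = (D≡ at p) q
        ... | false = refl

    isMove⇔sameMargins : ∀ {D P M} → IsDifference D P M → IsMove S D ⇔ SameMarginsℕ S P M
    isMove⇔sameMargins D≡ = mk⇔
      (λ (rows0 , cols0 , inside0) → record
        { rows   = λ p → vanishing⇒≡ (trans (sym (rowSum-difference D≡ p)) (rows0 p))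
        ; cols   = λ q → vanishing⇒≡ (trans (sym (colSum-difference D≡ q)) (cols0 q))
        ; inside = vanishing⇒≡ (trans (sym (SSum-difference D≡)) inside0)
        })
      (λ sm → (λ p → trans (rowSum-difference D≡ p) (≡⇒vanishing (rows sm p)))
            , (λ q → trans (colSum-difference D≡ q) (≡⇒vanishing (cols sm q)))
            , trans (SSum-difference D≡) (≡⇒vanishing (inside sm)))
      where
      vanishing⇒≡ : ∀ {a b} → + a ℤ.- + b ≡ ℤ.0ℤ → a ≡ b
      vanishing⇒≡ {a} {b} eq = ℤₚ.+-injective (ℤₚ.i-j≡0⇒i≡j (+ a) (+ b) eq)
      ≡⇒vanishing : ∀ {a b} → a ≡ b → + a ℤ.- + b ≡ ℤ.0ℤ
      ≡⇒vanishing {a} refl = ℤₚ.+-inverseʳ (+ a)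

    rowSum-toℤ : ∀ X p → rowSum (toℤ X) p ≡ + rowTotal X p
    rowSum-toℤ X p = sumℤ-+ (X p)

    colSum-toℤ : ∀ X q → colSum (toℤ X) q ≡ + colTotal X q
    colSum-toℤ X q = sumℤ-+ (λ p → X p q)

    SSum-toℤ : ∀ X → SSum S (toℤ X) ≡ + mass (restrict S X)
    SSum-toℤ X = trans (sumℤ-cong (λ p → trans (sumℤ-cong (restricted p)) (sumℤ-+ (restrict S X p))))
                     (sumℤ-+ (rowTotal (restrict S X)))
      where
      restricted : ∀ p q → (if S p q then + X p q else ℤ.0ℤ) ≡ + restrict S X p q
      restricted p q with S p q
      ... | true  = refl
      ... | false = refl

    sameMargins⇒sameMarginsℕ : ∀ {X Y} → SameMargins S (toℤ X) (toℤ Y) → SameMarginsℕ S X Y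
    sameMargins⇒sameMarginsℕ {X} {Y} (rows= , cols= , inside=) = record
      { rows   = λ p → ℤₚ.+-injective (trans (sym (rowSum-toℤ X p)) (trans (rows= p) (rowSum-toℤ Y p)))
      ; cols   = λ q → ℤₚ.+-injective (trans (sym (colSum-toℤ X q)) (trans (cols= q) (colSum-toℤ Y q)))
      ; inside = ℤₚ.+-injective (trans (sym (SSum-toℤ X)) (trans inside= (SSum-toℤ Y)))
      }

    sameMarginsℕ⇒sameMargins : ∀ {X Y Z} → SameMarginsℕ S X Y → Z ≈ toℤ Y → SameMargins S (toℤ X) Z
    sameMarginsℕ⇒sameMargins {X} {Y} sm Z≈ =
      (λ p → trans (rowSum-toℤ X p) (trans (cong +_ (rows sm p)) (sym (trans (sumℤ-cong (Z≈ p)) (rowSum-toℤ Y p))))) ,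
      (λ q → trans (colSum-toℤ X q) (trans (cong +_ (cols sm q)) (sym (trans (sumℤ-cong (λ p → Z≈ p q)) (colSum-toℤ Y q))))) ,
      trans (SSum-toℤ X) (trans (cong +_ (inside sm)) (sym (trans (sumℤ-cong (λ p → sumℤ-cong (λ q →
        cong (λ x → if S p q then x else ℤ.0ℤ) (Z≈ p q)))) (SSum-toℤ Y))))

    inFiber : ∀ {X₀ X Z} → SameMarginsℕ S X₀ X → Z ≈ toℤ X → InFiberOf S X₀ Z
    inFiber sm Z≈ = (λ p q → subst (ℤ._≤_ ℤ.0ℤ) (sym (Z≈ p q)) (ℤ.+≤+ z≤n)) , sameMarginsℕ⇒sameMargins sm Z≈

    basicMove-isMove : ∀ {i i' j j'} → i ≢ i' → j ≢ j' → Balanced S i i' j j' → IsMove S (basicMove i i' j j')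
    basicMove-isMove i≢i' j≢j' bal =
      Equivalence.from (isMove⇔sameMargins (basicMove-difference i≢i' j≢j')) (balanced⇒sameMargins bal)

    move∈B₀ : ∀ {X Y} (s : BasicStep S X Y) → B₀ S (BasicStep.move s)
    move∈B₀ (basicStep i i' j j' i≢i' j≢j' bal _) =
      i , i' , j , j' , i≢i' , j≢j' , (λ _ _ → refl) , basicMove-isMove i≢i' j≢j' bal

    move-⊕ : ∀ {X Y} (s : BasicStep S X Y) → (toℤ X ⊕ BasicStep.move s) ≈ toℤ Y
    move-⊕ {X} {Y} (basicStep i i' j j' i≢i' j≢j' _ res) p q =
      trans (cong (ℤ._+_ (+ X p q)) ((basicMove-difference i≢i' j≢j' at p) q)) (shift (res p q))
      where
      open ≡-Reasoning
      shift : ∀ {x y a b} → y + b ≡ x + a → + x ℤ.+ (+ a ℤ.- + b) ≡ + y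
      shift {x} {y} {a} {b} y+b≡x+a = begin
        + x ℤ.+ (+ a ℤ.- + b)   ≡⟨ x+[y-z]≡[x+y]-z (+ x) (+ a) (+ b) ⟩
        (+ x ℤ.+ + a) ℤ.- + b   ≡⟨ cong (ℤ._- + b) (sym (ℤₚ.pos-+ x a)) ⟩
        + (x + a) ℤ.- + b       ≡⟨ cong (λ z → + z ℤ.- + b) (sym y+b≡x+a) ⟩
        + (y + b) ℤ.- + b       ≡⟨ cong (ℤ._- + b) (ℤₚ.pos-+ y b) ⟩
        (+ y ℤ.+ + b) ℤ.- + b   ≡⟨ [x+y]-y≡x (+ y) (+ b) ⟩
        + y                     ∎

    B₀-neg : ∀ M → B₀ S M → B₀ S (neg M)
    B₀-neg M (i , i' , j , j' , i≢i' , j≢j' , M≈ , isMove) =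
      i , i' , j' , j , i≢i' , ≢-sym j≢j' , neg≈ ,
      Equivalence.from (isMove⇔sameMargins negDiff)
        (sameMargins-sym (Equivalence.to (isMove⇔sameMargins MDiff) isMove))
      where
      MDiff : IsDifference M (plusPart i i' j j') (minusPart i i' j j')
      MDiff = difference λ p q → trans (M≈ p q) ((basicMove-difference i≢i' j≢j' at p) q)
      negDiff : IsDifference (neg M) (minusPart i i' j j') (plusPart i i' j j')
      negDiff = difference λ p q → trans (cong ℤ.-_ ((MDiff at p) q)) (-[x-y]≡y-x (+ plusPart i i' j j' p q) (+ minusPart i i' j j' p q))
      neg≈ : neg M ≈ basicMove i i' j' j
      neg≈ p q = trans ((negDiff at p) q) (sym ((basicMove-difference i≢i' (≢-sym j≢j') at p) q))

    B₀-finite : FiniteSet (B₀ S)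
    B₀-finite = map (λ (i , i' , j , j') → basicMove i i' j j') quadruples , listed
      where
      quadruples : List (Fin r × Fin r × Fin c × Fin c)
      quadruples = cartesianProduct (allFin r) (cartesianProduct (allFin r) (cartesianProduct (allFin c) (allFin c)))
      listed : ∀ M → B₀ S M → Any.Any (M ≈_) (map (λ (i , i' , j , j') → basicMove i i' j j') quadruples)
      listed M (i , i' , j , j' , _ , _ , M≈ , _) = Any.map (λ { refl → M≈ })
        (∈-map⁺ _ (∈-cartesianProduct⁺ (∈-allFin i) (∈-cartesianProduct⁺ (∈-allFin i')
          (∈-cartesianProduct⁺ (∈-allFin j) (∈-allFin j')))))

    path⇒moves : ∀ {X₀ X Y} → SameMarginsℕ S X₀ X → (W : Array r c ℤ.ℤ) → W ≈ toℤ X → Path S X Y →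
      Σ (List (Array r c ℤ.ℤ)) λ Bs →
        All (B₀ S) Bs × All (InFiberOf S X₀) (partialSums W Bs) × (total W Bs ≈ toℤ Y)
    path⇒moves sm W W≈ (end X≋Y) = [] , [] , [] , λ p q → trans (W≈ p q) (cong +_ (X≋Y p q))
    path⇒moves sm W W≈ (s ◅ π) =
      let Bs , inB₀ , inFibers , total≈ = path⇒moves sm' (W ⊕ BasicStep.move s) W⊕move≈ π
      in BasicStep.move s ∷ Bs , move∈B₀ s ∷ inB₀ , inFiber sm' W⊕move≈ ∷ inFibers , total≈
      where
      sm' = sameMargins-trans sm (basicStep-sameMargins s)
      W⊕move≈ : (W ⊕ BasicStep.move s) ≈ toℤ _
      W⊕move≈ p q = trans (cong (ℤ._+ BasicStep.move s p q) (W≈ p q)) (move-⊕ s p q)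

    isMarkovBasis-B₀ : (∀ X Y → SameMarginsℕ S X Y → Path S X Y) → IsMarkovBasis S (B₀ S)
    isMarkovBasis-B₀ connected =
      B₀-finite ,
      (λ M (_ , _ , _ , _ , _ , _ , _ , isMove) → isMove) ,
      B₀-neg ,
      λ X Y sm → path⇒moves (sameMargins-≋ (λ _ _ → refl)) (toℤ X) (λ _ _ → refl)
                   (connected X Y (sameMargins⇒sameMarginsℕ sm))

-- Threshold subsets

rearrangement : ∀ {x x' y y'} → x < x' → y < y' → x * y' + x' * y < x * y + x' * y'
rearrangement {x} {_} {y} x<x' y<y' with ℕₚ.m≤n⇒∃[o]m+o≡n x<x' | ℕₚ.m≤n⇒∃[o]m+o≡n y<y'
... | d , refl | e , refl =
  subst (x * (suc y + e) + (suc x + d) * y <_) (sym (expand x d y e)) (ℕₚ.m<m+n _ (s≤s z≤n))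
  where
  expand : ∀ x d y e → x * y + (suc x + d) * (suc y + e) ≡ x * (suc y + e) + (suc x + d) * y + suc d * suc e
  expand = ℕ-solve-∀

module Threshold {r c : ℕ} (S : Subset r c) (ρ : Fin r → ℕ) (γ : Fin c → ℕ)
  (ρ-injective : Injective _≡_ _≡_ ρ) (γ-injective : Injective _≡_ _≡_ γ)
  (ρ≢γ : ∀ p q → ρ p ≢ γ q) (S-spec : ∀ p q → S p q ≡ true ⇔ ρ p < γ q) where

  open SameMarginsℕ

  ∈S⇒< : ∀ {p q} → S p q ≡ true → ρ p < γ q
  ∈S⇒< = Equivalence.to (S-spec _ _)

  <⇒∈S : ∀ {p q} → ρ p < γ q → S p q ≡ true
  <⇒∈S = Equivalence.from (S-spec _ _)

  ∉S⇒> : ∀ {p q} → S p q ≡ false → γ q < ρ p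
  ∉S⇒> {p} {q} pq∉S =
    ℕₚ.≤∧≢⇒< (ℕₚ.≮⇒≥ (λ ρ<γ → true≢false (trans (sym (<⇒∈S ρ<γ)) pq∉S))) (≢-sym (ρ≢γ p q))
    where
    true≢false : true ≢ false
    true≢false ()

  >⇒∉S : ∀ {p q} → γ q < ρ p → S p q ≡ false
  >⇒∉S {p} {q} γ<ρ with S p q in pq
  ... | false = refl
  ... | true  = ⊥-elim (ℕₚ.<-asym γ<ρ (∈S⇒< pq))

  balanced : ∀ {i i' j j' x y x' y'} → S i j ≡ x → S i' j' ≡ y → S i j' ≡ x' → S i' j ≡ y' →
    𝟙 x + 𝟙 y ≡ 𝟙 x' + 𝟙 y' → Balanced S i i' j j'
  balanced refl refl refl refl eq = eq

  key : Fin r → Fin c → ℕ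
  key p q = ρ p ⊔ γ q

  key-∈S : ∀ {p q} → S p q ≡ true → key p q ≡ γ q
  key-∈S pq∈S = ℕₚ.m≤n⇒m⊔n≡n (ℕₚ.<⇒≤ (∈S⇒< pq∈S))

  key-∉S : ∀ {p q} → S p q ≡ false → key p q ≡ ρ p
  key-∉S pq∉S = ℕₚ.m≥n⇒m⊔n≡m (ℕₚ.<⇒≤ (∉S⇒> pq∉S))

  ρ<key⇒∈S : ∀ {p q} → ρ p < key p q → S p q ≡ true
  ρ<key⇒∈S {p} {q} ρ<key with S p q in pq
  ... | true  = refl
  ... | false = ⊥-elim (ℕₚ.<-irrefl (sym (key-∉S pq)) ρ<key)

  γ<key⇒∉S : ∀ {p q} → γ q < key p q → S p q ≡ false
  γ<key⇒∉S {p} {q} γ<key with S p q in pq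
  ... | false = refl
  ... | true  = ⊥-elim (ℕₚ.<-irrefl (sym (key-∈S pq)) γ<key)

  ≤key⇒≤ρ : ∀ {p q m} → γ q < m → m ≤ key p q → m ≤ ρ p
  ≤key⇒≤ρ γ<m m≤key = subst (_ ≤_) (key-∉S (γ<key⇒∉S (ℕₚ.<-≤-trans γ<m m≤key))) m≤key

  ≤key⇒≤γ : ∀ {p q m} → ρ p < m → m ≤ key p q → m ≤ γ q
  ≤key⇒≤γ ρ<m m≤key = subst (_ ≤_) (key-∈S (ρ<key⇒∈S (ℕₚ.<-≤-trans ρ<m m≤key))) m≤key

  Improvable : Table r c → Set
  Improvable X = ∃₂ λ i i' → ∃₂ λ a b →
    ρ i < ρ i' × γ a < γ b × 0 < X i a × 0 < X i' b × Balanced S i i' b a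

  Reduced : Table r c → Set
  Reduced X = ¬ Improvable X

  improvable? : ∀ X → Dec (Improvable X)
  improvable? X = any? λ i → any? λ i' → any? λ a → any? λ b →
    ρ i <? ρ i' ×-dec γ a <? γ b ×-dec 0 <? X i a ×-dec 0 <? X i' b ×-dec
    𝟙 (S i b) + 𝟙 (S i' a) ℕₚ.≟ 𝟙 (S i a) + 𝟙 (S i' b)

  reduced-≤ : ∀ {X Y} → (∀ p q → Y p q ≤ X p q) → Reduced X → Reduced Y
  reduced-≤ Y≤X reducedX (i , i' , a , b , ρi<ρi' , γa<γb , Yia>0 , Yi'b>0 , bal) =
    reducedX (i , i' , a , b , ρi<ρi' , γa<γb ,
              ℕₚ.<-≤-trans Yia>0 (Y≤X i a) , ℕₚ.<-≤-trans Yi'b>0 (Y≤X i' b) , bal)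

  potential : Table r c → ℕ
  potential X = mass (λ p q → ρ p * γ q * X p q)

  potential-cong : ∀ {X Y} → X ≋ Y → potential X ≡ potential Y
  potential-cong X≋Y = mass-cong (λ p q → cong (ρ p * γ q *_) (X≋Y p q))

  potential-⊞ : ∀ X Y → potential (X ⊞ Y) ≡ potential X + potential Y
  potential-⊞ X Y = trans (mass-cong (λ p q → ℕₚ.*-distribˡ-+ (ρ p * γ q) (X p q) (Y p q)))
    (mass-⊞ (λ p q → ρ p * γ q * X p q) (λ p q → ρ p * γ q * Y p q))

  potential-plusPart : ∀ i i' j j' → potential (plusPart i i' j j') ≡ ρ i * γ j + ρ i' * γ j'
  potential-plusPart i i' j j' =
    trans (potential-⊞ (δ i j) (δ i' j')) (cong₂ _+_ (potential-δ i j) (potential-δ i' j'))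
    where
    potential-δ : ∀ i j → potential (δ i j) ≡ ρ i * γ j
    potential-δ i j = trans
      (mass-single (λ p q → ρ p * γ q * δ i j p q) i j
        (λ p q off → trans (cong (ρ p * γ q *_) (δ-off i j p q off)) (ℕₚ.*-zeroʳ (ρ p * γ q))))
      (trans (cong (ρ i * γ j *_) (δ-diag i j)) (ℕₚ.*-identityʳ _))

  potential-decreases : ∀ {X X' i i' a b} → ρ i < ρ i' → γ a < γ b →
    X' ⊞ plusPart i i' a b ≋ X ⊞ plusPart i i' b a → potential X' < potential X
  potential-decreases {X} {X'} {i} {i'} {a} {b} ρi<ρi' γa<γb X'≋X =
    ℕₚ.+-cancelʳ-< (potential (plusPart i i' a b)) _ _ (begin-strict
      potential X' + potential (plusPart i i' a b) ≡⟨ potential-⊞ X' (plusPart i i' a b) ⟨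
      potential (X' ⊞ plusPart i i' a b)           ≡⟨ potential-cong X'≋X ⟩
      potential (X ⊞ plusPart i i' b a)            ≡⟨ potential-⊞ X (plusPart i i' b a) ⟩
      potential X + potential (plusPart i i' b a)  <⟨ ℕₚ.+-monoʳ-< (potential X) plus<minus ⟩
      potential X + potential (plusPart i i' a b)  ∎)
    where
    open ℕₚ.≤-Reasoning
    plus<minus : potential (plusPart i i' b a) < potential (plusPart i i' a b)
    plus<minus = subst₂ _<_ (sym (potential-plusPart i i' b a)) (sym (potential-plusPart i i' a b))
                            (rearrangement ρi<ρi' γa<γb)

  improve : ∀ {X} → Improvable X → ∃ λ X' → BasicStep S X X' × potential X' < potential X
  improve {X} (i , i' , a , b , ρi<ρi' , γa<γb , Xia>0 , Xi'b>0 , bal) =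
    X' , step , potential-decreases ρi<ρi' γa<γb (BasicStep.result step)
    where
    X' : Table r c
    X' p q = X p q + plusPart i i' b a p q ∸ minusPart i i' b a p q
    i≢i' : i ≢ i'
    i≢i' refl = ℕₚ.<-irrefl refl ρi<ρi'
    b≢a : b ≢ a
    b≢a refl = ℕₚ.<-irrefl refl γa<γb
    step : BasicStep S X X'
    step = basicStep-from i i' b a i≢i' b≢a bal (plusPart-≤ {X = X} i≢i' Xia>0 Xi'b>0)

  reduce : ∀ X → ∃ λ X* → Path S X X* × Reduced X*
  reduce X = descend X (<-wellFounded (potential X))
    where
    descend : ∀ X → Acc _<_ (potential X) → ∃ λ X* → Path S X X* × Reduced X*
    descend X (acc smaller) with improvable? X
    ... | no reduced = X , end (λ _ _ → refl) , reduced
    ... | yes improvable =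
      let X' , step , decreases = improve improvable
          X* , path , reduced   = descend X' (smaller decreases)
      in X* , step ◅ path , reduced

  KeysAtLeast : Table r c → ℕ → Set
  KeysAtLeast X m = ∀ p q → 0 < X p q → m ≤ key p q

  record MinimalCell (X : Table r c) : Set where
    constructor minimalCell
    field
      row      : Fin r
      col      : Fin c
      positive : 0 < X row col
      minimal  : KeysAtLeast X (key row col)

  open MinimalCell

  minimalCell-of : ∀ X → 0 < mass X → MinimalCell X
  minimalCell-of X mass>0 =
    let p , q , Xpq>0 = mass-positive X mass>0 in descend p q Xpq>0 (<-wellFounded (key p q))
    where
    descend : ∀ p q → 0 < X p q → Acc _<_ (key p q) → MinimalCell X
    descend p q Xpq>0 (acc smaller) with any? (λ p' → any? λ q' → 0 <? X p' q' ×-dec key p' q' <? key p q)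
    ... | yes (p' , q' , Xp'q'>0 , lower) = descend p' q' Xp'q'>0 (smaller lower)
    ... | no none = minimalCell p q Xpq>0 (λ p' q' Xp'q'>0 → ℕₚ.≮⇒≥ (λ lower → none (p' , q' , Xp'q'>0 , lower)))

  rowsBelow colsBelow : Table r c → ℕ → ℕ
  rowsBelow X = sumBelow ρ (rowTotal X)
  colsBelow X = sumBelow γ (colTotal X)

  Breakpoint : Table r c → ℕ → Set
  Breakpoint X m =
    rowsBelow X m ≤ mass (restrict S X) × colsBelow X m ≤ mass (restrict (∁ S) X) ×
    (mass (restrict S X) < rowsBelow X (suc m) ⊎ mass (restrict (∁ S) X) < colsBelow X (suc m))

  breakpoints-ordered : ∀ {X m m'} → Breakpoint X m → Breakpoint X m' → m < m' → ⊥
  breakpoints-ordered {X} (_ , _ , inj₁ inside<rows) (rows≤inside , _ , _) m<m' =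
    ℕₚ.<⇒≱ inside<rows (ℕₚ.≤-trans (sumBelow-mono ρ (rowTotal X) m<m') rows≤inside)
  breakpoints-ordered {X} (_ , _ , inj₂ outside<cols) (_ , cols≤outside , _) m<m' =
    ℕₚ.<⇒≱ outside<cols (ℕₚ.≤-trans (sumBelow-mono γ (colTotal X) m<m') cols≤outside)

  breakpoint-unique : ∀ {X m m'} → Breakpoint X m → Breakpoint X m' → m ≡ m'
  breakpoint-unique {m = m} {m'} bp bp' with ℕₚ.<-cmp m m'
  ... | tri< m<m' _ _ = ⊥-elim (breakpoints-ordered bp bp' m<m')
  ... | tri≈ _ m≡m' _ = m≡m'
  ... | tri> _ _ m'<m = ⊥-elim (breakpoints-ordered bp' bp m'<m)

  breakpoint-transport : ∀ {X Y m} → SameMarginsℕ S X Y → Breakpoint X m → Breakpoint Y m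
  breakpoint-transport {m = m} sm (rows≤inside , cols≤outside , excess) =
    subst₂ _≤_ (rowsBelow≡ m) (inside sm) rows≤inside ,
    subst₂ _≤_ (colsBelow≡ m) (sameMargins-outside sm) cols≤outside ,
    Sum.map (subst₂ _<_ (inside sm) (rowsBelow≡ (suc m)))
            (subst₂ _<_ (sameMargins-outside sm) (colsBelow≡ (suc m))) excess
    where
    rowsBelow≡ = sumBelow-cong ρ (rows sm)
    colsBelow≡ = sumBelow-cong γ (cols sm)

  rowsBelow-≤-inside : ∀ {X m} → KeysAtLeast X m → rowsBelow X m ≤ mass (restrict S X)
  rowsBelow-≤-inside {X} keys = sumBelow-≤ ρ (rowTotal X) λ p ρp<m → sum-mono-≤ λ q →
    ≤-restrict S X p q (λ Xpq>0 → ρ<key⇒∈S (ℕₚ.<-≤-trans ρp<m (keys p q Xpq>0)))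

  colsBelow-≤-outside : ∀ {X m} → KeysAtLeast X m → colsBelow X m ≤ mass (restrict (∁ S) X)
  colsBelow-≤-outside {X} {m} keys = subst (colsBelow X m ≤_) (sym (mass-colTotal (restrict (∁ S) X)))
    (sumBelow-≤ γ (colTotal X) λ q γq<m → sum-mono-≤ λ p →
      ≤-restrict (∁ S) X p q (λ Xpq>0 → cong not (γ<key⇒∉S (ℕₚ.<-≤-trans γq<m (keys p q Xpq>0)))))

  inside<rowsBelow : ∀ {X i b} → Reduced X → 0 < X i b → S i b ≡ false →
    mass (restrict S X) < rowsBelow X (suc (ρ i))
  inside<rowsBelow {X} {i} {b} reduced Xib>0 ib∉S =
    sum-<-sumBelow ρ (rowTotal X) (λ p → sum-mono-≤ (restrict-≤ S X p)) noneBelow i (ℕₚ.n<1+n (ρ i))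
      (sum-mono-< (restrict-≤ S X i) b restricted<)
    where
    restricted< : restrict S X i b < X i b
    restricted< rewrite ib∉S = Xib>0
    noneBelow : ∀ p → suc (ρ i) ≤ ρ p → rowTotal (restrict S X) p ≡ 0
    noneBelow p ρi<ρp = sum-≡0 vanish
      where
      vanish : ∀ q → restrict S X p q ≡ 0
      vanish q with S p q in pq
      ... | false = refl
      ... | true  = ¬>0⇒≡0 λ Xpq>0 → reduced (i , p , b , q , ρi<ρp ,
        ℕₚ.<-trans (∉S⇒> ib∉S) (ℕₚ.<-trans ρi<ρp (∈S⇒< pq)) , Xib>0 , Xpq>0 ,
        balanced (<⇒∈S (ℕₚ.<-trans ρi<ρp (∈S⇒< pq))) (>⇒∉S (ℕₚ.<-trans (∉S⇒> ib∉S) ρi<ρp)) ib∉S pq refl)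

  outside<colsBelow : ∀ {X i a} → Reduced X → 0 < X i a → S i a ≡ true →
    mass (restrict (∁ S) X) < colsBelow X (suc (γ a))
  outside<colsBelow {X} {i} {a} reduced Xia>0 ia∈S =
    subst (_< colsBelow X (suc (γ a))) (sym (mass-colTotal (restrict (∁ S) X)))
      (sum-<-sumBelow γ (colTotal X) (λ q → sum-mono-≤ (λ p → restrict-≤ (∁ S) X p q)) noneBelow a (ℕₚ.n<1+n (γ a))
        (sum-mono-< (λ p → restrict-≤ (∁ S) X p a) i restricted<))
    where
    restricted< : restrict (∁ S) X i a < X i a
    restricted< rewrite ia∈S = Xia>0
    noneBelow : ∀ q → suc (γ a) ≤ γ q → colTotal (restrict (∁ S) X) q ≡ 0
    noneBelow q γa<γq = sum-≡0 vanish
      where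
      vanish : ∀ p → restrict (∁ S) X p q ≡ 0
      vanish p with S p q in pq
      ... | true  = refl
      ... | false = ¬>0⇒≡0 λ Xpq>0 → reduced (i , p , a , q ,
        ℕₚ.<-trans (∈S⇒< ia∈S) (ℕₚ.<-trans γa<γq (∉S⇒> pq)) , γa<γq , Xia>0 , Xpq>0 ,
        balanced (<⇒∈S (ℕₚ.<-trans (∈S⇒< ia∈S) γa<γq)) (>⇒∉S (ℕₚ.<-trans γa<γq (∉S⇒> pq))) ia∈S pq refl)

  minimalCell-breakpoint : ∀ {X} → Reduced X → (cell : MinimalCell X) → Breakpoint X (key (row cell) (col cell))
  minimalCell-breakpoint {X} reduced (minimalCell i j Xij>0 minimal) =
    rowsBelow-≤-inside minimal , colsBelow-≤-outside minimal , excess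
    where
    excess : mass (restrict S X) < rowsBelow X (suc (key i j)) ⊎ mass (restrict (∁ S) X) < colsBelow X (suc (key i j))
    excess with S i j in ij
    ... | false = inj₁ (subst (λ m → mass (restrict S X) < rowsBelow X (suc m)) (sym (key-∉S ij))
                              (inside<rowsBelow reduced Xij>0 ij))
    ... | true  = inj₂ (subst (λ m → mass (restrict (∁ S) X) < colsBelow X (suc m)) (sym (key-∈S ij))
                              (outside<colsBelow reduced Xij>0 ij))

  minimalKeys-agree : ∀ {X Y} → Reduced X → Reduced Y → SameMarginsℕ S X Y →
    (cellˣ : MinimalCell X) (cellʸ : MinimalCell Y) → key (row cellˣ) (col cellˣ) ≡ key (row cellʸ) (col cellʸ)
  minimalKeys-agree reducedX reducedY sm cellˣ cellʸ = breakpoint-unique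
    (minimalCell-breakpoint reducedX cellˣ)
    (breakpoint-transport (sameMargins-sym sm) (minimalCell-breakpoint reducedY cellʸ))

  sameRow-positive : ∀ {X i b b'} → Reduced X → 0 < X i b → KeysAtLeast X (ρ i) →
    γ b < γ b' → γ b' < ρ i → 0 < colTotal X b' → 0 < X i b'
  sameRow-positive {X} {i} {b} {b'} reduced Xib>0 keys γb<γb' γb'<ρi col>0
    with sum-positive (λ p → X p b') col>0
  ... | p , Xpb'>0 with ℕₚ.m≤n⇒m<n∨m≡n (≤key⇒≤ρ γb'<ρi (keys p b' Xpb'>0))
  ...   | inj₂ ρi≡ρp = subst (λ z → 0 < X z b') (ρ-injective (sym ρi≡ρp)) Xpb'>0
  ...   | inj₁ ρi<ρp = ⊥-elim (reduced (i , p , b , b' , ρi<ρp , γb<γb' , Xib>0 , Xpb'>0 ,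
    balanced (>⇒∉S γb'<ρi) (>⇒∉S (ℕₚ.<-trans (ℕₚ.<-trans γb<γb' γb'<ρi) ρi<ρp))
             (>⇒∉S (ℕₚ.<-trans γb<γb' γb'<ρi)) (>⇒∉S (ℕₚ.<-trans γb'<ρi ρi<ρp)) refl))

  sameCol-positive : ∀ {X i i' a} → Reduced X → 0 < X i a → KeysAtLeast X (γ a) →
    ρ i < ρ i' → ρ i' < γ a → 0 < rowTotal X i' → 0 < X i' a
  sameCol-positive {X} {i} {i'} {a} reduced Xia>0 keys ρi<ρi' ρi'<γa row>0
    with sum-positive (X i') row>0
  ... | q , Xi'q>0 with ℕₚ.m≤n⇒m<n∨m≡n (≤key⇒≤γ ρi'<γa (keys i' q Xi'q>0))
  ...   | inj₂ γa≡γq = subst (λ z → 0 < X i' z) (γ-injective (sym γa≡γq)) Xi'q>0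
  ...   | inj₁ γa<γq = ⊥-elim (reduced (i , i' , a , q , ρi<ρi' , γa<γq , Xia>0 , Xi'q>0 ,
    balanced (<⇒∈S (ℕₚ.<-trans ρi<ρi' (ℕₚ.<-trans ρi'<γa γa<γq))) (<⇒∈S ρi'<γa)
             (<⇒∈S (ℕₚ.<-trans ρi<ρi' ρi'<γa)) (<⇒∈S (ℕₚ.<-trans ρi'<γa γa<γq)) refl))

  CommonSupport : Table r c → Table r c → Set
  CommonSupport X Y = ∃₂ λ p q → 0 < X p q × 0 < Y p q

  commonSupport-row : ∀ {X Y i i' b b'} → Reduced X → Reduced Y → SameMarginsℕ S X Y →
    0 < X i b → KeysAtLeast X (ρ i) → S i b ≡ false →
    0 < Y i' b' → KeysAtLeast Y (ρ i') → S i' b' ≡ false → ρ i ≡ ρ i' → CommonSupport X Y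
  commonSupport-row {X} {Y} {i} {b = b} {b'} reducedX reducedY sm Xib>0 keysX ib∉S Yib'>0 keysY ib'∉S ρi≡ρi'
    with ρ-injective ρi≡ρi'
  ... | refl with ℕₚ.<-cmp (γ b) (γ b')
  ...   | tri< γb<γb' _ _ =
    i , b' , sameRow-positive reducedX Xib>0 keysX γb<γb' (∉S⇒> ib'∉S) (colTotal-positive sm Yib'>0) , Yib'>0
  ...   | tri≈ _ γb≡γb' _ = i , b , Xib>0 , subst (λ z → 0 < Y i z) (γ-injective (sym γb≡γb')) Yib'>0
  ...   | tri> _ _ γb'<γb =
    i , b , Xib>0 , sameRow-positive reducedY Yib'>0 keysY γb'<γb (∉S⇒> ib∉S) (colTotal-positive (sameMargins-sym sm) Xib>0)

  commonSupport-col : ∀ {X Y i i' a a'} → Reduced X → Reduced Y → SameMarginsℕ S X Y →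
    0 < X i a → KeysAtLeast X (γ a) → S i a ≡ true →
    0 < Y i' a' → KeysAtLeast Y (γ a') → S i' a' ≡ true → γ a ≡ γ a' → CommonSupport X Y
  commonSupport-col {X} {Y} {i} {i'} {a} reducedX reducedY sm Xia>0 keysX ia∈S Yi'a>0 keysY i'a∈S γa≡γa'
    with γ-injective γa≡γa'
  ... | refl with ℕₚ.<-cmp (ρ i) (ρ i')
  ...   | tri< ρi<ρi' _ _ =
    i' , a , sameCol-positive reducedX Xia>0 keysX ρi<ρi' (∈S⇒< i'a∈S) (rowTotal-positive sm Yi'a>0) , Yi'a>0
  ...   | tri≈ _ ρi≡ρi' _ = i , a , Xia>0 , subst (λ z → 0 < Y z a) (ρ-injective (sym ρi≡ρi')) Yi'a>0
  ...   | tri> _ _ ρi'<ρi =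
    i , a , Xia>0 , sameCol-positive reducedY Yi'a>0 keysY ρi'<ρi (∈S⇒< ia∈S) (rowTotal-positive (sameMargins-sym sm) Xia>0)

  commonSupport : ∀ {X Y} → Reduced X → Reduced Y → SameMarginsℕ S X Y →
    MinimalCell X → MinimalCell Y → CommonSupport X Y
  commonSupport reducedX reducedY sm cellˣ cellʸ =
    byCases cellˣ cellʸ (minimalKeys-agree reducedX reducedY sm cellˣ cellʸ)
    where
    byCases : (cellˣ : MinimalCell _) (cellʸ : MinimalCell _) →
      key (row cellˣ) (col cellˣ) ≡ key (row cellʸ) (col cellʸ) → CommonSupport _ _
    byCases (minimalCell i j Xij>0 minimalX) (minimalCell i' j' Yi'j'>0 minimalY) sameKey
      with S i j in ij | S i' j' in i'j'
    ... | false | false = commonSupport-row reducedX reducedY sm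
      Xij>0 (subst (KeysAtLeast _) (key-∉S ij) minimalX) ij
      Yi'j'>0 (subst (KeysAtLeast _) (key-∉S i'j') minimalY) i'j'
      (trans (sym (key-∉S ij)) (trans sameKey (key-∉S i'j')))
    ... | true  | true  = commonSupport-col reducedX reducedY sm
      Xij>0 (subst (KeysAtLeast _) (key-∈S ij) minimalX) ij
      Yi'j'>0 (subst (KeysAtLeast _) (key-∈S i'j') minimalY) i'j'
      (trans (sym (key-∈S ij)) (trans sameKey (key-∈S i'j')))
    ... | false | true  = ⊥-elim (ρ≢γ i j' (trans (sym (key-∉S ij)) (trans sameKey (key-∈S i'j'))))
    ... | true  | false = ⊥-elim (ρ≢γ i' j (sym (trans (sym (key-∈S ij)) (trans sameKey (key-∉S i'j')))))

  reduced-unique : ∀ {X Y} → Reduced X → Reduced Y → SameMarginsℕ S X Y → X ≋ Y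
  reduced-unique {X} = peel (<-wellFounded (mass X))
    where
    peel : ∀ {X Y} → Acc _<_ (mass X) → Reduced X → Reduced Y → SameMarginsℕ S X Y → X ≋ Y
    peel {X} {Y} (acc smaller) reducedX reducedY sm with mass X ℕₚ.≟ 0
    ... | yes empty = λ p q →
      trans (mass≡0⇒≡0 X empty p q) (sym (mass≡0⇒≡0 Y (trans (sym (sameMargins-mass sm)) empty) p q))
    ... | no nonempty = peelCommon (commonSupport reducedX reducedY sm
      (minimalCell-of X (ℕₚ.n≢0⇒n>0 nonempty))
      (minimalCell-of Y (subst (0 <_) (sameMargins-mass sm) (ℕₚ.n≢0⇒n>0 nonempty))))
      where
      peelCommon : CommonSupport X Y → X ≋ Y
      peelCommon (i , j , Xij>0 , Yij>0) = decrement-≋ Xij>0 Yij>0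
        (peel (smaller (mass-decrement {X = X} Xij>0))
              (reduced-≤ (decrement-≤ X i j) reducedX) (reduced-≤ (decrement-≤ Y i j) reducedY)
              (sameMargins-decrement Xij>0 Yij>0 sm))

  connected : ∀ X Y → SameMarginsℕ S X Y → Path S X Y
  connected X Y sm =
    let X* , X⇝X* , reducedX* = reduce X
        Y* , Y⇝Y* , reducedY* = reduce Y
        sm* = sameMargins-trans (sameMargins-sym (path-sameMargins X⇝X*))
                                (sameMargins-trans sm (path-sameMargins Y⇝Y*))
    in X⇝X* ◅◅ path-respˡ (reduced-unique reducedX* reducedY* sm*) (reverse Y⇝Y*)

  isMarkovBasis : IsMarkovBasis S (B₀ S)
  isMarkovBasis = isMarkovBasis-B₀ connected

-- Staircases

odd<even⇔< : ∀ {x y} → suc (2 * x) < 2 * y ⇔ x < y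
odd<even⇔< {x} {y} = mk⇔
  (λ odd<even → ℕₚ.*-cancelˡ-≤ 2 (subst (_≤ 2 * y) (sym (ℕₚ.*-suc 2 x)) odd<even))
  (λ x<y → subst (_≤ 2 * y) (ℕₚ.*-suc 2 x) (ℕₚ.*-monoʳ-≤ 2 x<y))

<∸⇔+< : ∀ {x y n} → y ≤ n → x < n ∸ y ⇔ x + y < n
<∸⇔+< {x} y≤n = mk⇔ (ℕₚ.m≤o∸n⇒m+n≤o (suc x) y≤n) (ℕₚ.m+n≤o⇒m≤o∸n (suc x))

proposition4 : (n : ℕ) → 1 ≤ n → (S : Subset n (suc n)) →
    (σ : Permutation′ n) → (π : Permutation′ (suc n)) →
    (∀ a b → (S a b ≡ true) ⇔
       (∃ λ (i : Fin n) → ∃ λ (j : Fin (suc n)) →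
          (toℕ i + toℕ j < n) × (a ≡ σ ⟨$⟩ʳ i) × (b ≡ π ⟨$⟩ʳ j))) →
    IsMarkovBasis S (B₀ S)
proposition4 n _ S σ π S⇔staircase =
  Threshold.isMarkovBasis S ρ γ ρ-injective γ-injective ρ≢γ S⇔ρ<γ
  where
  ρ : Fin n → ℕ
  ρ a = suc (2 * toℕ (σ ⟨$⟩ˡ a))

  γ : Fin (suc n) → ℕ
  γ b = 2 * (n ∸ toℕ (π ⟨$⟩ˡ b))

  ρ≢γ : ∀ a b → ρ a ≢ γ b
  ρ≢γ a b = ℕₚ.even≢odd (n ∸ toℕ (π ⟨$⟩ˡ b)) (toℕ (σ ⟨$⟩ˡ a)) ∘ sym

  toℕ-π⁻¹≤n : ∀ b → toℕ (π ⟨$⟩ˡ b) ≤ n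
  toℕ-π⁻¹≤n b = ℕₚ.≤-pred (toℕ<n (π ⟨$⟩ˡ b))

  ρ-injective : Injective _≡_ _≡_ ρ
  ρ-injective {a} {a'} ρa≡ρa' = begin
    a                       ≡⟨ inverseʳ σ ⟨
    σ ⟨$⟩ʳ (σ ⟨$⟩ˡ a)         ≡⟨ cong (σ ⟨$⟩ʳ_) (toℕ-injective (ℕₚ.*-cancelˡ-≡ _ _ 2 (ℕₚ.suc-injective ρa≡ρa'))) ⟩
    σ ⟨$⟩ʳ (σ ⟨$⟩ˡ a')        ≡⟨ inverseʳ σ ⟩
    a'                      ∎
    where open ≡-Reasoning

  γ-injective : Injective _≡_ _≡_ γ
  γ-injective {b} {b'} γb≡γb' = begin
    b                       ≡⟨ inverseʳ π ⟨
    π ⟨$⟩ʳ (π ⟨$⟩ˡ b)         ≡⟨ cong (π ⟨$⟩ʳ_) (toℕ-injective (ℕₚ.∸-cancelˡ-≡ (toℕ-π⁻¹≤n b) (toℕ-π⁻¹≤n b')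
                                (ℕₚ.*-cancelˡ-≡ _ _ 2 γb≡γb'))) ⟩
    π ⟨$⟩ʳ (π ⟨$⟩ˡ b')        ≡⟨ inverseʳ π ⟩
    b'                      ∎
    where open ≡-Reasoning

  S⇔ρ<γ : ∀ a b → S a b ≡ true ⇔ ρ a < γ b
  S⇔ρ<γ a b = mk⇔
    (λ ab∈S → let i , j , i+j<n , a≡σi , b≡πj = Equivalence.to (S⇔staircase a b) ab∈S in
      Equivalence.from odd<even⇔< (Equivalence.from (<∸⇔+< (toℕ-π⁻¹≤n b))
        (subst₂ (λ i' j' → toℕ i' + toℕ j' < n)
                (trans (sym (inverseˡ σ)) (cong (σ ⟨$⟩ˡ_) (sym a≡σi)))
                (trans (sym (inverseˡ π)) (cong (π ⟨$⟩ˡ_) (sym b≡πj))) i+j<n)))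
    (λ ρa<γb → Equivalence.from (S⇔staircase a b)
      ( σ ⟨$⟩ˡ a , π ⟨$⟩ˡ b
      , Equivalence.to (<∸⇔+< (toℕ-π⁻¹≤n b)) (Equivalence.to odd<even⇔< ρa<γb)
      , sym (inverseʳ σ) , sym (inverseʳ π)))
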